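{- Let $r,t,n$ be integers with $1\le t<r$, and let $\mathcal{C}=\mathcal{C}_{n,t}^{(r)}$ be the $r$-uniform $t$-tight cycle of order $n$ and length $\ell>2$. Then $\chi^{e}(\mathcal{C})=3$ if $t=\frac r2$ and $\ell\not\equiv 0\pmod 4$; $\chi^{e}(\mathcal{C})=2$ if either ($t=\frac r2$ and $\ell\equiv 0\pmod 4$) or ($t>\frac r2$ and $r-t$ divides $r$); and $\chi^{e}(\mathcal{C})=1$ otherwise.
   Context: The $r$-uniform $t$-tight cycle $\mathcal{C}_{n,t}^{(r)}$ has vertex set $\{1,\dots,n\}$ and edges $e_1,\dots,e_\ell$, where $\ell=\frac{n}{r-t}$ is an integer and $e_i=\{(i-1)(r-t)+1,(i-1)(r-t)+2,\dots,(i-1)(r-t)+r\}$ with vertex labels taken modulo $n$; consecutive edges (cyclically) share exactly $t$ vertices. For $w:E\to\{1,\dots,k\}$, $\sigma^{e}(v)=\sum_{e\ni v}w(e)$; a vertex coloring is proper if every edge contains two vertices of distinct colors; $\chi^{e}(\mathcal{H})$ is the least $k$ such that some $w$ makes $\sigma^{e}$ proper. -}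

module Defs where

open import Data.Nat using (ℕ; zero; suc; _+_; _*_; _∸_; _≤_; _<_; NonZero)
open import Data.Nat.DivMod using (_mod_)
open import Data.Fin using (Fin; toℕ)
import Data.Fin.Properties as FinP
open import Data.List using (List; map; upTo; allFin)
open import Data.Nat.ListAction using (sum)
open import Data.List.Membership.Propositional using (_∈_)
import Data.List.Membership.DecPropositional as DecMem
open import Data.Product using (Σ; ∃; _×_; _,_)
open import Relation.Nullary using (¬_; does)
open import Relation.Binary.PropositionalEquality using (_≡_; _≢_)
open import Data.Bool using (if_then_else_)

-- The r-uniform t-tight cycle C^{(r)}_{n,t} with ℓ edges, vertices 0,…,n-1
-- (paper's vertex v+1 is our v).  Edge e_i (i = 0,…,ℓ-1; paper's e_{i+1})
-- is { (i(r-t) + j) mod n : j = 0,…,r-1 }, given as a list of vertices.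
edge : (r t n ℓ : ℕ) .{{_ : NonZero n}} → Fin ℓ → List (Fin n)
edge r t n ℓ i = map (λ j → (toℕ i * (r ∸ t) + j) mod n) (upTo r)

σᵉ : (r t n ℓ : ℕ) .{{_ : NonZero n}} → (Fin ℓ → ℕ) → Fin n → ℕ
σᵉ r t n ℓ w v =
  sum (map (λ i → if does (DecMem._∈?_ (FinP._≟_ {n}) v (edge r t n ℓ i)) then w i else 0) (allFin ℓ))

Proper : (r t n ℓ : ℕ) .{{_ : NonZero n}} → (Fin n → ℕ) → Set
Proper r t n ℓ c =
  (i : Fin ℓ) → Σ (Fin n) λ u → Σ (Fin n) λ v →
    (u ∈ edge r t n ℓ i) × (v ∈ edge r t n ℓ i) × (c u ≢ c v)

Weightable : (r t n ℓ : ℕ) .{{_ : NonZero n}} → ℕ → Set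
Weightable r t n ℓ k =
  Σ (Fin ℓ → ℕ) λ w → ((i : Fin ℓ) → 1 ≤ w i × w i ≤ k) × Proper r t n ℓ (σᵉ r t n ℓ w)

ChiE≡ : (r t n ℓ : ℕ) .{{_ : NonZero n}} → ℕ → Set
ChiE≡ r t n ℓ k = Weightable r t n ℓ k × ((m : ℕ) → m < k → ¬ Weightable r t n ℓ m)

-- Cut the cycle into ℓ blocks of s = r − t consecutive vertices and write r = q·s + c with c < s:
-- edge i consists of the blocks i, …, i + q − 1 and the first c vertices of block i + q. So the
-- vertex in slot b of block a gets σ = W(a) + [b < c]·w(a − q), where W(a) = w(a) + ⋯ + w(a − q + 1).
-- If c > 0, the all-ones weighting already separates slots 0 and c inside every edge.
-- If c = 0, σ is constant on blocks and W(a + 1) − W(a) = w(a + 1) − w(a + 1 − q): constant weights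
-- fail, and an edge is proper as soon as w(m) ≠ w(m − q) for one of its inner positions m.
-- For q = 2 (that is, t = r/2) this says w(j) ≠ w(j + 2) for every j, which two colours achieve
-- exactly when 4 ∣ ℓ and three colours always achieve. For q ≥ 3 (t > r/2 and s ∣ r) two colours
-- suffice: colour m by the parity of ⌊m/q⌋ and repair the wrap-around at one position.

module Submission where

open import Defs
open import Data.Bool using (Bool; true; false; if_then_else_)
open import Data.Empty using (⊥-elim)
open import Data.Fin using (Fin; toℕ; zero; suc; fromℕ<)
import Data.Fin.Properties as FinP
open import Data.List using ([]; _∷_; map; allFin)
open import Data.List.Membership.Propositional using (_∈_)
open import Data.List.Membership.Propositional.Properties using (∈-map⁺; ∈-map⁻; ∈-upTo⁺; ∈-upTo⁻)
import Data.List.Membership.DecPropositional as DecMem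
open import Data.List.Properties using (map-cong; map-tabulate)
open import Data.Nat
  using (ℕ; zero; suc; _+_; _*_; _∸_; _≤_; _<_; _%_; _/_; _<?_; _≤?_; _≟_;
         NonZero; >-nonZero; >-nonZero⁻¹; z≤n; s≤s; s≤s⁻¹)
open import Data.Nat.DivMod
open import Data.Nat.Divisibility using (_∣_; divides; m%n≡0⇒n∣m; _∣0; ∣-refl; ∣m∣n⇒∣m+n; n∣m*n)
open import Data.Nat.ListAction using (sum)
open import Data.Nat.Properties
open import Algebra.Properties.CommutativeSemigroup +-commutativeSemigroup using (interchange; x∙yz≈y∙xz)
open import Data.Nat.Tactic.RingSolver using (solve-∀)
open import Data.Product using (Σ; ∃; _×_; _,_; proj₁; proj₂)
open import Data.Sum using (_⊎_; inj₁; inj₂; [_,_]′)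
open import Function using (_∘′_)
open import Function.Bundles using (_⇔_; mk⇔; Equivalence)
open import Relation.Binary.Definitions using (tri<; tri≈; tri>)
open import Relation.Binary.PropositionalEquality
open import Relation.Nullary using (Dec; yes; no; does; ¬_)
open import Relation.Nullary.Decidable using (dec-true; dec-false; does-⇔; _×-dec_)

infix 8 ⟦_⟧·_

⟦_⟧·_ : Bool → ℕ → ℕ
⟦ b ⟧· x = if b then x else 0

⟦⟧·-yes : ∀ {P : Set} (p : Dec P) {x} → P → ⟦ does p ⟧· x ≡ x
⟦⟧·-yes p {x} h = cong (⟦_⟧· x) (dec-true p h)

⟦⟧·-no : ∀ {P : Set} (p : Dec P) {x} → ¬ P → ⟦ does p ⟧· x ≡ 0
⟦⟧·-no p {x} h = cong (⟦_⟧· x) (dec-false p h)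

∑ : ∀ {m} → (Fin m → ℕ) → ℕ
∑ f = sum (map f (allFin _))

∑-cong : ∀ {m} {f g : Fin m → ℕ} → (∀ i → f i ≡ g i) → ∑ f ≡ ∑ g
∑-cong f≗g = cong sum (map-cong f≗g (allFin _))

sum-map-+ : ∀ {A : Set} (f g : A → ℕ) xs → sum (map (λ x → f x + g x) xs) ≡ sum (map f xs) + sum (map g xs)
sum-map-+ f g [] = refl
sum-map-+ f g (x ∷ xs) = trans (cong (f x + g x +_) (sum-map-+ f g xs)) (interchange (f x) (g x) _ _)

∑-+ : ∀ {m} (f g : Fin m → ℕ) → ∑ (λ i → f i + g i) ≡ ∑ f + ∑ g
∑-+ f g = sum-map-+ f g (allFin _)

∑-suc : ∀ {m} (f : Fin (suc m) → ℕ) → ∑ f ≡ f zero + ∑ (λ i → f (suc i))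
∑-suc {m} f = cong (λ xs → f zero + sum xs)
  (trans (map-tabulate suc f) (sym (map-tabulate (λ i → i) (λ i → f (suc i)))))

∑-0 : ∀ m → ∑ {m} (λ _ → 0) ≡ 0
∑-0 zero = refl
∑-0 (suc m) = trans (∑-suc {m} (λ _ → 0)) (∑-0 m)

∑-⟦≟⟧ : ∀ {m} (j : Fin m) (w : Fin m → ℕ) → ∑ (λ i → ⟦ does (i FinP.≟ j) ⟧· w i) ≡ w j
∑-⟦≟⟧ {suc m} zero w = trans (∑-suc {m} (λ i → ⟦ does (i FinP.≟ zero) ⟧· w i))
  (trans (cong (w zero +_) (∑-0 m)) (+-identityʳ (w zero)))
∑-⟦≟⟧ {suc m} (suc j) w = trans (∑-suc {m} (λ i → ⟦ does (i FinP.≟ suc j) ⟧· w i))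
  (∑-⟦≟⟧ j (λ i → w (suc i)))

⟦<suc⟧ : ∀ o k x → ⟦ does (o <? suc k) ⟧· x ≡ ⟦ does (o <? k) ⟧· x + ⟦ does (o ≟ k) ⟧· x
⟦<suc⟧ o k x with <-cmp o k
... | tri< o<k o≢k _ = begin
  ⟦ does (o <? suc k) ⟧· x                     ≡⟨ ⟦⟧·-yes (o <? suc k) (m<n⇒m<1+n o<k) ⟩
  x                                             ≡⟨ +-identityʳ x ⟨
  x + 0                                         ≡⟨ cong₂ _+_ (⟦⟧·-yes (o <? k) o<k) (⟦⟧·-no (o ≟ k) o≢k) ⟨
  ⟦ does (o <? k) ⟧· x + ⟦ does (o ≟ k) ⟧· x  ∎
  where open ≡-Reasoning
... | tri≈ o≮k o≡k _ = begin
  ⟦ does (o <? suc k) ⟧· x                     ≡⟨ ⟦⟧·-yes (o <? suc k) (s≤s (≤-reflexive o≡k)) ⟩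
  x                                             ≡⟨ cong₂ _+_ (⟦⟧·-no (o <? k) o≮k) (⟦⟧·-yes (o ≟ k) o≡k) ⟨
  ⟦ does (o <? k) ⟧· x + ⟦ does (o ≟ k) ⟧· x  ∎
  where open ≡-Reasoning
... | tri> o≮k o≢k k<o = begin
  ⟦ does (o <? suc k) ⟧· x                     ≡⟨ ⟦⟧·-no (o <? suc k) (<⇒≱ k<o ∘′ s≤s⁻¹) ⟩
  0                                             ≡⟨ cong₂ _+_ (⟦⟧·-no (o <? k) o≮k) (⟦⟧·-no (o ≟ k) o≢k) ⟨
  ⟦ does (o <? k) ⟧· x + ⟦ does (o ≟ k) ⟧· x  ∎
  where open ≡-Reasoning

<⇒*+<*+ : ∀ {s b c d q} → b < s → d < q → d * s + b < q * s + c
<⇒*+<*+ {s} {b} {c} {d} {q} b<s d<q = begin-strict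
  d * s + b   <⟨ +-monoʳ-< (d * s) b<s ⟩
  d * s + s   ≡⟨ +-comm (d * s) s ⟩
  suc d * s   ≤⟨ *-monoˡ-≤ s d<q ⟩
  q * s       ≤⟨ m≤m+n (q * s) c ⟩
  q * s + c   ∎
  where open ≤-Reasoning

⟦*+<*+⟧ : ∀ {s b c} d q x → b < s → c < s →
  ⟦ does (d * s + b <? q * s + c) ⟧· x ≡ ⟦ does (d <? q) ⟧· x + ⟦ does (d ≟ q) ⟧· (⟦ does (b <? c) ⟧· x)
⟦*+<*+⟧ {s} {b} {c} d q x b<s c<s with <-cmp d q
... | tri< d<q d≢q _ = begin
  ⟦ does (d * s + b <? q * s + c) ⟧· x  ≡⟨ ⟦⟧·-yes (d * s + b <? q * s + c) (<⇒*+<*+ b<s d<q) ⟩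
  x                                      ≡⟨ +-identityʳ x ⟨
  x + 0                                  ≡⟨ cong₂ _+_ (⟦⟧·-yes (d <? q) d<q) (⟦⟧·-no (d ≟ q) d≢q) ⟨
  ⟦ does (d <? q) ⟧· x + ⟦ does (d ≟ q) ⟧· (⟦ does (b <? c) ⟧· x) ∎
  where open ≡-Reasoning
... | tri≈ d≮d refl _ = begin
  ⟦ does (d * s + b <? d * s + c) ⟧· x  ≡⟨ cong (⟦_⟧· x) (does-⇔ (mk⇔ (+-cancelˡ-< (d * s) b c) (+-monoʳ-< (d * s)))
                                                              (d * s + b <? d * s + c) (b <? c)) ⟩
  ⟦ does (b <? c) ⟧· x                  ≡⟨ cong₂ _+_ (⟦⟧·-no (d <? d) d≮d) (⟦⟧·-yes (d ≟ d) refl) ⟨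
  ⟦ does (d <? d) ⟧· x + ⟦ does (d ≟ d) ⟧· (⟦ does (b <? c) ⟧· x) ∎
  where open ≡-Reasoning
... | tri> d≮q d≢q q<d = begin
  ⟦ does (d * s + b <? q * s + c) ⟧· x  ≡⟨ ⟦⟧·-no (d * s + b <? q * s + c) (<⇒≯ (<⇒*+<*+ c<s q<d)) ⟩
  0                                      ≡⟨ cong₂ _+_ (⟦⟧·-no (d <? q) d≮q) (⟦⟧·-no (d ≟ q) d≢q) ⟨
  ⟦ does (d <? q) ⟧· x + ⟦ does (d ≟ q) ⟧· (⟦ does (b <? c) ⟧· x) ∎
  where open ≡-Reasoning

one-or-two : ∀ {x} → 1 ≤ x × x ≤ 2 → x ≡ 1 ⊎ x ≡ 2
one-or-two {1} _ = inj₁ refl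
one-or-two {2} _ = inj₂ refl
one-or-two {0} (() , _)
one-or-two {suc (suc (suc _))} (_ , s≤s (s≤s ()))

≢∧≢⇒≡ : ∀ {a b c} → 1 ≤ a × a ≤ 2 → 1 ≤ b × b ≤ 2 → 1 ≤ c × c ≤ 2 → a ≢ b → b ≢ c → a ≡ c
≢∧≢⇒≡ a∈ b∈ c∈ a≢b b≢c with one-or-two a∈ | one-or-two b∈ | one-or-two c∈
... | inj₁ refl | _         | inj₁ refl = refl
... | inj₂ refl | _         | inj₂ refl = refl
... | inj₁ refl | inj₁ refl | _         = ⊥-elim (a≢b refl)
... | inj₁ refl | inj₂ refl | inj₂ refl = ⊥-elim (b≢c refl)
... | inj₂ refl | inj₁ refl | inj₁ refl = ⊥-elim (b≢c refl)
... | inj₂ refl | inj₂ refl | _         = ⊥-elim (a≢b refl)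

x%2≢[1+x]%2 : ∀ x → x % 2 ≢ (1 + x) % 2
x%2≢[1+x]%2 x eq = parity (x % 2) (m%n<n x 2) (trans eq (%-distribˡ-+ 1 x 2))
  where
  parity : ∀ y → y < 2 → y ≢ (1 % 2 + y) % 2
  parity 0 _ ()
  parity 1 _ ()
  parity (suc (suc _)) (s≤s (s≤s ()))

[x%4]/2≤1 : ∀ x → (x % 4) / 2 ≤ 1
[x%4]/2≤1 x = /-monoˡ-≤ 2 (s≤s⁻¹ (m%n<n x 4))

[x%4]/2≢[[x+2]%4]/2 : ∀ x → (x % 4) / 2 ≢ ((x + 2) % 4) / 2
[x%4]/2≢[[x+2]%4]/2 x eq = halves (x % 4) (m%n<n x 4) (trans eq (cong (_/ 2) (%-distribˡ-+ x 2 4)))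
  where
  halves : ∀ y → y < 4 → y / 2 ≢ ((y + 2 % 4) % 4) / 2
  halves 0 _ ()
  halves 1 _ ()
  halves 2 _ ()
  halves 3 _ ()
  halves (suc (suc (suc (suc _)))) (s≤s (s≤s (s≤s (s≤s ()))))

module _ {A : Set} (f : ℕ → A) (f≢f+2 : ∀ x → f x ≢ f (x + 2)) (f+4≡f : ∀ x → f (x + 4) ≡ f x) where

  return⇒even : ∀ m → f (m * 2) ≡ f 0 → 2 ∣ m
  return⇒even zero _ = 2 ∣0
  return⇒even (suc zero) f2≡f0 = ⊥-elim (f≢f+2 0 (sym f2≡f0))
  return⇒even (suc (suc m)) f[2m+4]≡f0 = ∣m∣n⇒∣m+n (∣-refl {2}) (return⇒even m (begin
    f (m * 2)               ≡⟨ f+4≡f (m * 2) ⟨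
    f (m * 2 + 4)           ≡⟨ cong f (2m+4 m) ⟩
    f (suc (suc m) * 2)     ≡⟨ f[2m+4]≡f0 ⟩
    f 0                     ∎))
    where
    open ≡-Reasoning
    2m+4 : ∀ m → m * 2 + 4 ≡ suc (suc m) * 2
    2m+4 = solve-∀

module Cycle (ℓ : ℕ) {{_ : NonZero ℓ}} where

  %-cong-+ʳ : ∀ {x y} z → x % ℓ ≡ y % ℓ → (x + z) % ℓ ≡ (y + z) % ℓ
  %-cong-+ʳ {x} {y} z x≡y = begin
    (x + z) % ℓ            ≡⟨ %-distribˡ-+ x z ℓ ⟩
    (x % ℓ + z % ℓ) % ℓ   ≡⟨ cong (λ u → (u + z % ℓ) % ℓ) x≡y ⟩
    (y % ℓ + z % ℓ) % ℓ   ≡⟨ %-distribˡ-+ y z ℓ ⟨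
    (y + z) % ℓ            ∎
    where open ≡-Reasoning

  %-cong-+ˡ : ∀ x {y z} → y % ℓ ≡ z % ℓ → (x + y) % ℓ ≡ (x + z) % ℓ
  %-cong-+ˡ x {y} {z} y≡z = begin
    (x + y) % ℓ ≡⟨ cong (_% ℓ) (+-comm x y) ⟩
    (y + x) % ℓ ≡⟨ %-cong-+ʳ x y≡z ⟩
    (z + x) % ℓ ≡⟨ cong (_% ℓ) (+-comm z x) ⟩
    (x + z) % ℓ ∎
    where open ≡-Reasoning

  -- a − i in ℤ/ℓ: block a lies `offset a i` blocks after the first block of edge i.
  offset : ℕ → Fin ℓ → ℕ
  offset a i = (a + (ℓ ∸ toℕ i)) % ℓ

  +-offset : ∀ a i → (toℕ i + offset a i) % ℓ ≡ a % ℓ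
  +-offset a i = begin
    (toℕ i + (a + (ℓ ∸ toℕ i)) % ℓ) % ℓ  ≡⟨ %-cong-+ˡ (toℕ i) (m%n%n≡m%n (a + (ℓ ∸ toℕ i)) ℓ) ⟩
    (toℕ i + (a + (ℓ ∸ toℕ i))) % ℓ       ≡⟨ cong (_% ℓ) (x∙yz≈y∙xz (toℕ i) a _) ⟩
    (a + (toℕ i + (ℓ ∸ toℕ i))) % ℓ       ≡⟨ cong (λ u → (a + u) % ℓ) (m+[n∸m]≡n (<⇒≤ (FinP.toℕ<n i))) ⟩
    (a + ℓ) % ℓ                             ≡⟨ [m+n]%n≡m%n a ℓ ⟩
    a % ℓ                                   ∎
    where open ≡-Reasoning

  [x+d+[ℓ∸d]]%ℓ : ∀ x {d} → d ≤ ℓ → (x + d + (ℓ ∸ d)) % ℓ ≡ x % ℓ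
  [x+d+[ℓ∸d]]%ℓ x {d} d≤ℓ = begin
    (x + d + (ℓ ∸ d)) % ℓ  ≡⟨ cong (_% ℓ) (+-assoc x d (ℓ ∸ d)) ⟩
    (x + (d + (ℓ ∸ d))) % ℓ ≡⟨ cong (λ u → (x + u) % ℓ) (m+[n∸m]≡n d≤ℓ) ⟩
    (x + ℓ) % ℓ              ≡⟨ [m+n]%n≡m%n x ℓ ⟩
    x % ℓ                    ∎
    where open ≡-Reasoning

  offset-unique : ∀ a i {d} → d < ℓ → (toℕ i + d) % ℓ ≡ a % ℓ → offset a i ≡ d
  offset-unique a i {d} d<ℓ i+d≡a = begin
    (a + (ℓ ∸ toℕ i)) % ℓ          ≡⟨ %-cong-+ʳ (ℓ ∸ toℕ i) (trans (sym i+d≡a) (cong (_% ℓ) (+-comm (toℕ i) d))) ⟩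
    (d + toℕ i + (ℓ ∸ toℕ i)) % ℓ  ≡⟨ [x+d+[ℓ∸d]]%ℓ d (<⇒≤ (FinP.toℕ<n i)) ⟩
    d % ℓ                           ≡⟨ m<n⇒m%n≡m d<ℓ ⟩
    d                               ∎
    where open ≡-Reasoning

  +-offset-suc : ∀ a i → (toℕ i + suc (offset a i)) % ℓ ≡ suc a % ℓ
  +-offset-suc a i = begin
    (toℕ i + suc (offset a i)) % ℓ ≡⟨ cong (_% ℓ) (+-suc (toℕ i) (offset a i)) ⟩
    suc (toℕ i + offset a i) % ℓ   ≡⟨ cong (_% ℓ) (+-comm 1 _) ⟩
    (toℕ i + offset a i + 1) % ℓ   ≡⟨ %-cong-+ʳ 1 (+-offset a i) ⟩
    (a + 1) % ℓ                     ≡⟨ cong (_% ℓ) (+-comm a 1) ⟩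
    suc a % ℓ                       ∎
    where open ≡-Reasoning

  offset-suc : ∀ a i → (suc (offset a i) < ℓ × offset (suc a) i ≡ suc (offset a i))
                     ⊎ (suc (offset a i) ≡ ℓ × offset (suc a) i ≡ 0)
  offset-suc a i with m≤n⇒m<n∨m≡n (m%n<n (a + (ℓ ∸ toℕ i)) ℓ)
  ... | inj₁ o+1<ℓ = inj₁ (o+1<ℓ , offset-unique (suc a) i o+1<ℓ (+-offset-suc a i))
  ... | inj₂ o+1≡ℓ = inj₂ (o+1≡ℓ , offset-unique (suc a) i (>-nonZero⁻¹ ℓ) (begin
    (toℕ i + 0) % ℓ                ≡⟨ cong (_% ℓ) (+-identityʳ (toℕ i)) ⟩
    toℕ i % ℓ                       ≡⟨ [m+n]%n≡m%n (toℕ i) ℓ ⟨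
    (toℕ i + ℓ) % ℓ                 ≡⟨ cong (λ u → (toℕ i + u) % ℓ) o+1≡ℓ ⟨
    (toℕ i + suc (offset a i)) % ℓ ≡⟨ +-offset-suc a i ⟩
    suc a % ℓ                       ∎))
    where open ≡-Reasoning

  toℕ-mod : ∀ x → toℕ (x mod ℓ) ≡ x % ℓ
  toℕ-mod x = FinP.toℕ-fromℕ< (m%n<n x ℓ)

  toℕ-mod-% : ∀ x → toℕ (x mod ℓ) % ℓ ≡ x % ℓ
  toℕ-mod-% x = trans (cong (_% ℓ) (toℕ-mod x)) (m%n%n≡m%n x ℓ)

  mod-cong : ∀ {x y} → x % ℓ ≡ y % ℓ → x mod ℓ ≡ y mod ℓ
  mod-cong {x} {y} x≡y = FinP.toℕ-injective (trans (toℕ-mod x) (trans x≡y (sym (toℕ-mod y))))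

  toℕ-mod-id : ∀ (j : Fin ℓ) → toℕ j mod ℓ ≡ j
  toℕ-mod-id j = FinP.toℕ-injective (trans (toℕ-mod (toℕ j)) (m<n⇒m%n≡m (FinP.toℕ<n j)))

  infixl 6 _⊖_

  -- a − d in ℤ/ℓ; only meaningful for d ≤ ℓ, since ∸ truncates.
  _⊖_ : ℕ → ℕ → Fin ℓ
  a ⊖ d = (a + (ℓ ∸ d)) mod ℓ

  ⊖-cong : ∀ {a a′} d → a % ℓ ≡ a′ % ℓ → a ⊖ d ≡ a′ ⊖ d
  ⊖-cong d a≡a′ = mod-cong (%-cong-+ʳ (ℓ ∸ d) a≡a′)

  ⊖0 : ∀ a → a ⊖ 0 ≡ a mod ℓ
  ⊖0 a = mod-cong ([m+n]%n≡m%n a ℓ)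

  ⊖-suc : ∀ a {d} → d < ℓ → a ⊖ d ≡ suc a ⊖ suc d
  ⊖-suc a {d} d<ℓ = cong (_mod ℓ) (begin
    a + (ℓ ∸ d)             ≡⟨ cong (a +_) (+-∸-assoc 1 d<ℓ) ⟩
    a + suc (ℓ ∸ suc d)     ≡⟨ +-suc a _ ⟩
    suc a + (ℓ ∸ suc d)     ∎)
    where open ≡-Reasoning

  +-⊖ : ∀ x {d} → d ≤ ℓ → (x + d) ⊖ d ≡ x mod ℓ
  +-⊖ x d≤ℓ = mod-cong ([x+d+[ℓ∸d]]%ℓ x d≤ℓ)

  ⊖-+ : ∀ a {d} → d ≤ ℓ → (toℕ (a ⊖ d) + d) % ℓ ≡ a % ℓ
  ⊖-+ a {d} d≤ℓ = begin
    (toℕ (a ⊖ d) + d) % ℓ      ≡⟨ %-cong-+ʳ d (toℕ-mod-% (a + (ℓ ∸ d))) ⟩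
    (a + (ℓ ∸ d) + d) % ℓ      ≡⟨ cong (_% ℓ) (+-assoc a (ℓ ∸ d) d) ⟩
    (a + ((ℓ ∸ d) + d)) % ℓ    ≡⟨ cong (λ u → (a + u) % ℓ) (m∸n+n≡m d≤ℓ) ⟩
    (a + ℓ) % ℓ                 ≡⟨ [m+n]%n≡m%n a ℓ ⟩
    a % ℓ                       ∎
    where open ≡-Reasoning

  offset≡⇔ : ∀ a i {d} → d < ℓ → offset a i ≡ d ⇔ i ≡ a ⊖ d
  offset≡⇔ a i {d} d<ℓ = mk⇔ to from
    where
    to : offset a i ≡ d → i ≡ a ⊖ d
    to o≡d = begin
      i                        ≡⟨ toℕ-mod-id i ⟨
      toℕ i mod ℓ              ≡⟨ +-⊖ (toℕ i) (<⇒≤ d<ℓ) ⟨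
      (toℕ i + d) ⊖ d          ≡⟨ ⊖-cong d (subst (λ o → (toℕ i + o) % ℓ ≡ a % ℓ) o≡d (+-offset a i)) ⟩
      a ⊖ d                    ∎
      where open ≡-Reasoning
    from : i ≡ a ⊖ d → offset a i ≡ d
    from refl = offset-unique a (a ⊖ d) d<ℓ (⊖-+ a (<⇒≤ d<ℓ))

  ∑-offset≟ : ∀ (w : Fin ℓ → ℕ) a {d} → d < ℓ → ∑ (λ i → ⟦ does (offset a i ≟ d) ⟧· w i) ≡ w (a ⊖ d)
  ∑-offset≟ w a {d} d<ℓ = trans
    (∑-cong λ i → cong (⟦_⟧· w i) (does-⇔ (offset≡⇔ a i d<ℓ) (offset a i ≟ d) (i FinP.≟ a ⊖ d)))
    (∑-⟦≟⟧ (a ⊖ d) w)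

  -- w(a) + w(a − 1) + ⋯ + w(a − k + 1)
  window : (Fin ℓ → ℕ) → ℕ → ℕ → ℕ
  window w a k = ∑ (λ i → ⟦ does (offset a i <? k) ⟧· w i)

  window-suc : ∀ w a {k} → k < ℓ → window w a (suc k) ≡ window w a k + w (a ⊖ k)
  window-suc w a {k} k<ℓ = begin
    window w a (suc k)                                          ≡⟨ ∑-cong (λ i → ⟦<suc⟧ (offset a i) k (w i)) ⟩
    ∑ (λ i → ⟦ does (offset a i <? k) ⟧· w i + ⟦ does (offset a i ≟ k) ⟧· w i) ≡⟨ ∑-+ {ℓ} _ _ ⟩
    window w a k + ∑ (λ i → ⟦ does (offset a i ≟ k) ⟧· w i)  ≡⟨ cong (window w a k +_) (∑-offset≟ w a k<ℓ) ⟩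
    window w a k + w (a ⊖ k)                                    ∎
    where open ≡-Reasoning

  ⟦offset-suc<suc⟧ : ∀ a i {k} x → k < ℓ →
    ⟦ does (offset (suc a) i <? suc k) ⟧· x ≡ ⟦ does (offset (suc a) i ≟ 0) ⟧· x + ⟦ does (offset a i <? k) ⟧· x
  ⟦offset-suc<suc⟧ a i {k} x k<ℓ with offset-suc a i
  ... | inj₁ (_ , o′≡1+o) rewrite o′≡1+o = refl
  ... | inj₂ (1+o≡ℓ , o′≡0) rewrite o′≡0 =
    sym (trans (cong (x +_) (⟦⟧·-no (offset a i <? k) λ o<k → <-irrefl 1+o≡ℓ (≤-<-trans o<k k<ℓ)))
               (+-identityʳ x))

  window-shift : ∀ w a {k} → k < ℓ → window w (suc a) (suc k) ≡ w (suc a mod ℓ) + window w a k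
  window-shift w a {k} k<ℓ = begin
    window w (suc a) (suc k)                                              ≡⟨ ∑-cong (λ i → ⟦offset-suc<suc⟧ a i (w i) k<ℓ) ⟩
    ∑ (λ i → ⟦ does (offset (suc a) i ≟ 0) ⟧· w i + ⟦ does (offset a i <? k) ⟧· w i) ≡⟨ ∑-+ {ℓ} _ _ ⟩
    ∑ (λ i → ⟦ does (offset (suc a) i ≟ 0) ⟧· w i) + window w a k
      ≡⟨ cong (_+ window w a k) (∑-offset≟ w (suc a) (>-nonZero⁻¹ ℓ)) ⟩
    w (suc a ⊖ 0) + window w a k                                          ≡⟨ cong (λ j → w j + window w a k) (⊖0 (suc a)) ⟩
    w (suc a mod ℓ) + window w a k                                        ∎
    where open ≡-Reasoning

  window-step : ∀ w a {p} → p < ℓ →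
    window w (suc a) (suc p) + w (suc a ⊖ suc p) ≡ window w a (suc p) + w (suc a mod ℓ)
  window-step w a {p} p<ℓ = begin
    window w (suc a) (suc p) + w (suc a ⊖ suc p)
      ≡⟨ cong₂ (λ x j → x + w j) (window-shift w a p<ℓ) (sym (⊖-suc a p<ℓ)) ⟩
    w (suc a mod ℓ) + window w a p + w (a ⊖ p)     ≡⟨ +-assoc (w (suc a mod ℓ)) _ _ ⟩
    w (suc a mod ℓ) + (window w a p + w (a ⊖ p))   ≡⟨ cong (w (suc a mod ℓ) +_) (window-suc w a p<ℓ) ⟨
    w (suc a mod ℓ) + window w a (suc p)           ≡⟨ +-comm (w (suc a mod ℓ)) _ ⟩
    window w a (suc p) + w (suc a mod ℓ)           ∎
    where open ≡-Reasoning

  window-suc≡⇔ : ∀ w a {p} → p < ℓ →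
    window w (suc a) (suc p) ≡ window w a (suc p) ⇔ w (suc a ⊖ suc p) ≡ w (suc a mod ℓ)
  window-suc≡⇔ w a {p} p<ℓ = mk⇔
    (λ eq → +-cancelˡ-≡ (window w a (suc p)) _ _
      (trans (cong (_+ w (suc a ⊖ suc p)) (sym eq)) (window-step w a p<ℓ)))
    (λ eq → +-cancelʳ-≡ (w (suc a ⊖ suc p)) _ _
      (trans (window-step w a p<ℓ) (cong (window w a (suc p) +_) (sym eq))))

  window-constant : ∀ w {p} → p < ℓ → (∀ i j → w i ≡ w j) → ∀ a → window w a (suc p) ≡ window w 0 (suc p)
  window-constant w p<ℓ w-const zero = refl
  window-constant w {p} p<ℓ w-const (suc a) = trans
    (Equivalence.from (window-suc≡⇔ w a p<ℓ) (w-const (suc a ⊖ suc p) (suc a mod ℓ)))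
    (window-constant w p<ℓ w-const a)

  plus2 : Fin ℓ → Fin ℓ
  plus2 j = (toℕ j + 2) mod ℓ

  plus2-mod : ∀ x → plus2 (x mod ℓ) ≡ (x + 2) mod ℓ
  plus2-mod x = mod-cong (%-cong-+ʳ 2 (toℕ-mod-% x))

  plus2-⊖2 : 2 ≤ ℓ → ∀ a → plus2 (a ⊖ 2) ≡ a mod ℓ
  plus2-⊖2 2≤ℓ a = mod-cong (⊖-+ a 2≤ℓ)

  ⊖2-plus1 : 2 ≤ ℓ → ∀ (j : Fin ℓ) → suc (toℕ ((toℕ j + 1) mod ℓ)) ⊖ 2 ≡ j
  ⊖2-plus1 2≤ℓ j = begin
    suc (toℕ ((toℕ j + 1) mod ℓ)) ⊖ 2   ≡⟨ ⊖-cong 2 (begin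
      suc (toℕ ((toℕ j + 1) mod ℓ)) % ℓ ≡⟨ cong (_% ℓ) (+-comm 1 _) ⟩
      (toℕ ((toℕ j + 1) mod ℓ) + 1) % ℓ ≡⟨ %-cong-+ʳ 1 (toℕ-mod-% (toℕ j + 1)) ⟩
      (toℕ j + 1 + 1) % ℓ                 ≡⟨ cong (_% ℓ) (+-assoc (toℕ j) 1 1) ⟩
      (toℕ j + 2) % ℓ                     ∎) ⟩
    (toℕ j + 2) ⊖ 2                      ≡⟨ +-⊖ (toℕ j) 2≤ℓ ⟩
    toℕ j mod ℓ                          ≡⟨ toℕ-mod-id j ⟩
    j                                    ∎
    where open ≡-Reasoning

  -- Along x ↦ x + 2 a two-valued w alternates, hence is 4-periodic; returning to the start after
  -- ℓ such steps forces ℓ to be even, and returning after ℓ/2 steps then forces ℓ/2 to be even.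
  alternating⇒4∣ℓ : ∀ (w : Fin ℓ → ℕ) → (∀ j → 1 ≤ w j × w j ≤ 2) → (∀ j → w j ≢ w (plus2 j)) → 4 ∣ ℓ
  alternating⇒4∣ℓ w w∈ w≢w∘plus2 =
    4∣ℓ (return⇒even f f≢f+2 f+4≡f ℓ (trans (cong f (ℓ*2≡0+ℓ+ℓ ℓ)) f0+ℓ+ℓ≡f0))
    where
    f : ℕ → ℕ
    f x = w (x mod ℓ)
    f≢f+2 : ∀ x → f x ≢ f (x + 2)
    f≢f+2 x eq = w≢w∘plus2 (x mod ℓ) (trans eq (cong w (sym (plus2-mod x))))
    f+4≡f : ∀ x → f (x + 4) ≡ f x
    f+4≡f x = ≢∧≢⇒≡ (w∈ _) (w∈ _) (w∈ _)
      (λ eq → f≢f+2 (x + 2) (trans (sym eq) (cong f (sym (+-assoc x 2 2)))))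
      (λ eq → f≢f+2 x (sym eq))
    f+ℓ≡f : ∀ x → f (x + ℓ) ≡ f x
    f+ℓ≡f x = cong w (mod-cong ([m+n]%n≡m%n x ℓ))
    f0+ℓ+ℓ≡f0 : f (0 + ℓ + ℓ) ≡ f 0
    f0+ℓ+ℓ≡f0 = trans (f+ℓ≡f (0 + ℓ)) (f+ℓ≡f 0)
    ℓ*2≡0+ℓ+ℓ : ∀ ℓ → ℓ * 2 ≡ 0 + ℓ + ℓ
    ℓ*2≡0+ℓ+ℓ = solve-∀
    4∣ℓ : 2 ∣ ℓ → 4 ∣ ℓ
    4∣ℓ (divides m ℓ≡m*2) with return⇒even f f≢f+2 f+4≡f m (trans (cong f (sym ℓ≡m*2)) (f+ℓ≡f 0))
    ... | divides k m≡k*2 = divides k (trans ℓ≡m*2 (trans (cong (_* 2) m≡k*2) (*-assoc k 2 2)))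

  stripes : Fin ℓ → ℕ
  stripes j = 1 + (toℕ j % 4) / 2

  stripes∈ : ∀ j → 1 ≤ stripes j × stripes j ≤ 2
  stripes∈ j = s≤s z≤n , s≤s ([x%4]/2≤1 (toℕ j))

  stripes-alternating : 4 ∣ ℓ → ∀ j → stripes j ≢ stripes (plus2 j)
  stripes-alternating 4∣ℓ j eq = [x%4]/2≢[[x+2]%4]/2 (toℕ j) (trans (suc-injective eq) (cong (_/ 2) (begin
    toℕ (plus2 j) % 4         ≡⟨ cong (_% 4) (toℕ-mod (toℕ j + 2)) ⟩
    (toℕ j + 2) % ℓ % 4       ≡⟨ m∣n⇒o%n%m≡o%m 4 ℓ (toℕ j + 2) 4∣ℓ ⟩
    (toℕ j + 2) % 4           ∎)))
    where open ≡-Reasoning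

  Tail : ℕ → Set
  Tail y = ℓ ≤ y + 2 × 2 ≤ y

  -- The pattern 1,2,2,1,1,2,2,… except for colour 3 at ℓ − 1 and (if it is ≥ 2) at ℓ − 2, which
  -- keeps y and y + 2 apart across the wrap-around as well.
  colour₃ : ℕ → ℕ
  colour₃ y = if does (ℓ ≤? y + 2 ×-dec 2 ≤? y) then 3 else 1 + ((y + 1) % 4) / 2

  colour₃-tail : ∀ {y} → Tail y → colour₃ y ≡ 3
  colour₃-tail {y} tail =
    cong (λ b → if b then 3 else 1 + ((y + 1) % 4) / 2) (dec-true (ℓ ≤? y + 2 ×-dec 2 ≤? y) tail)

  colour₃-body : ∀ {y} → ¬ Tail y → colour₃ y ≡ 1 + ((y + 1) % 4) / 2
  colour₃-body {y} ¬tail =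
    cong (λ b → if b then 3 else 1 + ((y + 1) % 4) / 2) (dec-false (ℓ ≤? y + 2 ×-dec 2 ≤? y) ¬tail)

  colour₃∈ : ∀ y → 1 ≤ colour₃ y × colour₃ y ≤ 3
  colour₃∈ y with does (ℓ ≤? y + 2 ×-dec 2 ≤? y)
  ... | true = s≤s z≤n , ≤-refl
  ... | false = s≤s z≤n , s≤s (≤-trans ([x%4]/2≤1 (y + 1)) (s≤s z≤n))

  colour₃-0 : colour₃ 0 ≡ 1
  colour₃-0 = colour₃-body {0} λ { (_ , ()) }

  colour₃-1 : colour₃ 1 ≡ 2
  colour₃-1 = colour₃-body {1} λ { (_ , s≤s ()) }

  colour₃-inner : ∀ {y} → y + 2 < ℓ → colour₃ y ≢ colour₃ ((y + 2) % ℓ)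
  colour₃-inner {y} y+2<ℓ eq = differ (ℓ ≤? y + 2 + 2 ×-dec 2 ≤? y + 2)
    (trans (sym (colour₃-body ¬tail)) (trans eq (cong colour₃ (m<n⇒m%n≡m y+2<ℓ))))
    where
    ¬tail : ¬ Tail y
    ¬tail (ℓ≤y+2 , _) = <⇒≱ y+2<ℓ ℓ≤y+2
    y+2+1≡y+1+2 : ∀ y → y + 2 + 1 ≡ y + 1 + 2
    y+2+1≡y+1+2 = solve-∀
    differ : Dec (Tail (y + 2)) → 1 + ((y + 1) % 4) / 2 ≢ colour₃ (y + 2)
    differ (yes tail) eq′ = <⇒≢ (s≤s (s≤s ([x%4]/2≤1 (y + 1)))) (trans eq′ (colour₃-tail tail))
    differ (no ¬tail′) eq′ = [x%4]/2≢[[x+2]%4]/2 (y + 1) (suc-injective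
      (trans eq′ (trans (colour₃-body ¬tail′) (cong (λ x → 1 + (x % 4) / 2) (y+2+1≡y+1+2 y)))))

  colour₃-wrap₀ : 2 < ℓ → ∀ {y} → y + 2 ≡ ℓ → colour₃ y ≢ colour₃ ((y + 2) % ℓ)
  colour₃-wrap₀ 2<ℓ {y} y+2≡ℓ eq = differ (2 ≤? y)
    (trans eq (trans (cong colour₃ (trans (cong (_% ℓ) y+2≡ℓ) (n%n≡0 ℓ))) colour₃-0))
    where
    differ : Dec (2 ≤ y) → colour₃ y ≢ 1
    differ (yes 2≤y) eq′ = 1+n≢0 (suc-injective (trans (sym (colour₃-tail (≤-reflexive (sym y+2≡ℓ) , 2≤y))) eq′))
    differ (no 2≰y) eq′ = 1+n≢0 (suc-injective (trans (sym colour₃-1) (trans (cong colour₃ (sym y≡1)) eq′)))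
      where
      y≡1 : y ≡ 1
      y≡1 = ≤-antisym (s≤s⁻¹ (≰⇒> 2≰y)) (+-cancelʳ-≤ 2 1 y (subst (3 ≤_) (sym y+2≡ℓ) 2<ℓ))

  colour₃-wrap₁ : 2 < ℓ → ∀ {y} → y < ℓ → ℓ < y + 2 → colour₃ y ≢ colour₃ ((y + 2) % ℓ)
  colour₃-wrap₁ 2<ℓ {y} y<ℓ ℓ<y+2 eq = 1+n≢n (suc-injective (begin
    3                     ≡⟨ colour₃-tail (<⇒≤ ℓ<y+2 , 2≤y) ⟨
    colour₃ y             ≡⟨ eq ⟩
    colour₃ ((y + 2) % ℓ) ≡⟨ cong colour₃ y+2%ℓ≡1 ⟩
    colour₃ 1             ≡⟨ colour₃-1 ⟩
    2                     ∎))
    where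
    open ≡-Reasoning
    y+1≡ℓ : y + 1 ≡ ℓ
    y+1≡ℓ = ≤-antisym (subst (_≤ ℓ) (+-comm 1 y) y<ℓ) (s≤s⁻¹ (subst (ℓ <_) (+-suc y 1) ℓ<y+2))
    2≤y : 2 ≤ y
    2≤y = +-cancelʳ-≤ 1 2 y (subst (3 ≤_) (sym y+1≡ℓ) 2<ℓ)
    y+2%ℓ≡1 : (y + 2) % ℓ ≡ 1
    y+2%ℓ≡1 = begin
      (y + 2) % ℓ       ≡⟨ cong (_% ℓ) (+-suc y 1) ⟩
      (1 + (y + 1)) % ℓ ≡⟨ cong (λ x → (1 + x) % ℓ) y+1≡ℓ ⟩
      (1 + ℓ) % ℓ       ≡⟨ [m+n]%n≡m%n 1 ℓ ⟩
      1 % ℓ             ≡⟨ m<n⇒m%n≡m (<-trans (s≤s (s≤s z≤n)) 2<ℓ) ⟩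
      1                 ∎

  colour₃-alternating : 2 < ℓ → ∀ y → y < ℓ → colour₃ y ≢ colour₃ ((y + 2) % ℓ)
  colour₃-alternating 2<ℓ y y<ℓ with <-cmp (y + 2) ℓ
  ... | tri< y+2<ℓ _ _ = colour₃-inner y+2<ℓ
  ... | tri≈ _ y+2≡ℓ _ = colour₃-wrap₀ 2<ℓ y+2≡ℓ
  ... | tri> _ _ ℓ<y+2 = colour₃-wrap₁ 2<ℓ y<ℓ ℓ<y+2

  stripes₃ : Fin ℓ → ℕ
  stripes₃ j = colour₃ (toℕ j)

  stripes₃-alternating : 2 < ℓ → ∀ j → stripes₃ j ≢ stripes₃ (plus2 j)
  stripes₃-alternating 2<ℓ j eq = colour₃-alternating 2<ℓ (toℕ j) (FinP.toℕ<n j)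
    (trans eq (cong colour₃ (toℕ-mod (toℕ j + 2))))

  -- Colouring y by the parity of ⌊y/q⌋ makes m and m − q differ for q ≤ m < ℓ; recolouring
  -- z = 1 − q makes m = 1 a flip too, and then every q − 1 consecutive positions contain a flip.
  module Runs {q} (3≤q : 3 ≤ q) (q<ℓ : q < ℓ) where

    instance
      q≢0 : NonZero q
      q≢0 = >-nonZero (≤-trans (s≤s z≤n) 3≤q)

    D z : ℕ
    D = ℓ ∸ q
    z = suc D

    D+q≡ℓ : D + q ≡ ℓ
    D+q≡ℓ = m∸n+n≡m (<⇒≤ q<ℓ)

    D+3≤ℓ : D + 3 ≤ ℓ
    D+3≤ℓ = subst (D + 3 ≤_) D+q≡ℓ (+-monoʳ-≤ D 3≤q)

    runs : ℕ → ℕ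
    runs y = if does (y ≟ z) then 2 else 1 + (y / q) % 2

    runs-z : runs z ≡ 2
    runs-z = cong (λ b → if b then 2 else 1 + (z / q) % 2) (dec-true (z ≟ z) refl)

    runs-≢z : ∀ {y} → y ≢ z → runs y ≡ 1 + (y / q) % 2
    runs-≢z {y} y≢z = cong (λ b → if b then 2 else 1 + (y / q) % 2) (dec-false (y ≟ z) y≢z)

    runs∈ : ∀ y → 1 ≤ runs y × runs y ≤ 2
    runs∈ y with does (y ≟ z)
    ... | true = s≤s z≤n , ≤-refl
    ... | false = s≤s z≤n , s≤s (s≤s⁻¹ (m%n<n (y / q) 2))

    FlipsAt : ℕ → Set
    FlipsAt m = runs (toℕ (m ⊖ q)) ≢ runs (toℕ (m mod ℓ))

    flipsAt-mod : ∀ {m m′} → m % ℓ ≡ m′ % ℓ → FlipsAt m → FlipsAt m′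
    flipsAt-mod {m} {m′} m≡m′ = subst₂ (λ j j′ → runs (toℕ j) ≢ runs (toℕ j′)) (⊖-cong q m≡m′) (mod-cong m≡m′)

    flipsAt-1 : FlipsAt 1
    flipsAt-1 eq = 1+n≢n (suc-injective (begin
      2                          ≡⟨ runs-z ⟨
      runs z                     ≡⟨ cong runs (m<n⇒m%n≡m z<ℓ) ⟨
      runs (z % ℓ)               ≡⟨ cong runs (toℕ-mod (1 + D)) ⟨
      runs (toℕ (1 ⊖ q))         ≡⟨ eq ⟩
      runs (toℕ (1 mod ℓ))       ≡⟨ cong runs (trans (toℕ-mod 1) (m<n⇒m%n≡m 1<ℓ)) ⟩
      runs 1                     ≡⟨ runs-≢z (λ 1≡z → <⇒≢ 1<z 1≡z) ⟩
      1 + (1 / q) % 2            ≡⟨ cong (λ x → 1 + x % 2) (m<n⇒m/n≡0 (≤-trans (s≤s (s≤s z≤n)) 3≤q)) ⟩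
      1                          ∎))
      where
      open ≡-Reasoning
      1<ℓ : 1 < ℓ
      1<ℓ = <-trans (≤-trans (s≤s (s≤s z≤n)) 3≤q) q<ℓ
      1<z : 1 < z
      1<z = s≤s (m<n⇒0<n∸m q<ℓ)
      z<ℓ : z < ℓ
      z<ℓ = ≤-trans (≤-reflexive (+-comm 2 D)) (≤-trans (+-monoʳ-≤ D (n≤1+n 2)) D+3≤ℓ)

    flipsAt-q : FlipsAt q
    flipsAt-q eq = 1+n≢n (suc-injective (begin
      2                          ≡⟨ runs-q ⟨
      runs q                     ≡⟨ cong runs (trans (toℕ-mod q) (m<n⇒m%n≡m q<ℓ)) ⟨
      runs (toℕ (q mod ℓ))       ≡⟨ eq ⟨
      runs (toℕ (q ⊖ q))         ≡⟨ cong runs (trans (toℕ-mod (q + D)) (trans (cong (_% ℓ) q+D≡ℓ) (n%n≡0 ℓ))) ⟩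
      runs 0                     ≡⟨ cong (λ x → 1 + x % 2) (0/n≡0 q) ⟩
      1                          ∎))
      where
      open ≡-Reasoning
      q+D≡ℓ : q + D ≡ ℓ
      q+D≡ℓ = trans (+-comm q D) D+q≡ℓ
      runs-q : runs q ≡ 2
      runs-q with q ≟ z
      ... | yes q≡z = trans (cong runs q≡z) runs-z
      ... | no q≢z = trans (runs-≢z q≢z) (cong (λ x → 1 + x % 2) (n/n≡1 q))

    flipsAt-middle : ∀ {m} → q ≤ m → m < ℓ → m ≢ z → FlipsAt m
    flipsAt-middle {m} q≤m m<ℓ m≢z eq = x%2≢[1+x]%2 ((m ∸ q) / q) (suc-injective (begin
      1 + ((m ∸ q) / q) % 2      ≡⟨ runs-≢z m∸q≢z ⟨
      runs (m ∸ q)               ≡⟨ cong runs m+D%ℓ≡m∸q ⟨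
      runs ((m + D) % ℓ)         ≡⟨ cong runs (toℕ-mod (m + D)) ⟨
      runs (toℕ (m ⊖ q))         ≡⟨ eq ⟩
      runs (toℕ (m mod ℓ))       ≡⟨ cong runs (trans (toℕ-mod m) (m<n⇒m%n≡m m<ℓ)) ⟩
      runs m                     ≡⟨ runs-≢z m≢z ⟩
      1 + (m / q) % 2            ≡⟨ cong (λ x → 1 + x % 2) (m/n≡1+[m∸n]/n q≤m) ⟩
      1 + (1 + (m ∸ q) / q) % 2  ∎))
      where
      open ≡-Reasoning
      m∸q<D : m ∸ q < D
      m∸q<D = ∸-monoˡ-< m<ℓ q≤m
      m∸q≢z : m ∸ q ≢ z
      m∸q≢z m∸q≡z = <-irrefl m∸q≡z (<-trans m∸q<D (n<1+n D))
      m+D%ℓ≡m∸q : (m + D) % ℓ ≡ m ∸ q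
      m+D%ℓ≡m∸q = begin
        (m + D) % ℓ                 ≡⟨ cong (λ x → (x + D) % ℓ) (m∸n+n≡m q≤m) ⟨
        (m ∸ q + q + D) % ℓ         ≡⟨ [x+d+[ℓ∸d]]%ℓ (m ∸ q) (<⇒≤ q<ℓ) ⟩
        (m ∸ q) % ℓ                 ≡⟨ m<n⇒m%n≡m (≤-<-trans (m∸n≤m m q) m<ℓ) ⟩
        m ∸ q                       ∎

    flipsAt-window : ∀ i → i < ℓ → ∃ λ e → suc e < q × FlipsAt (suc (i + e))
    flipsAt-window zero _ = 0 , ≤-trans (s≤s (s≤s z≤n)) 3≤q , flipsAt-1
    flipsAt-window (suc i) 1+i<ℓ with suc (suc i) ≤? q
    ... | yes 2+i≤q = q ∸ suc (suc i) , e+2≤q , subst FlipsAt (sym (m+[n∸m]≡n 2+i≤q)) flipsAt-q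
      where
      e+2≤q : suc (q ∸ suc (suc i)) < q
      e+2≤q = ≤-trans (s≤s (s≤s (∸-monoʳ-≤ q (s≤s (s≤s z≤n)))))
                      (≤-reflexive (m+[n∸m]≡n (≤-trans (s≤s (s≤s z≤n)) 3≤q)))
    ... | no 2+i≰q with suc (suc i) ≟ ℓ
    ...   | yes 2+i≡ℓ = 1 , 3≤q , flipsAt-mod (begin
      1 % ℓ                      ≡⟨ [m+n]%n≡m%n 1 ℓ ⟨
      (1 + ℓ) % ℓ                ≡⟨ cong (λ x → (1 + x) % ℓ) 2+i≡ℓ ⟨
      suc (suc (suc i)) % ℓ      ≡⟨ cong (λ x → suc x % ℓ) (+-comm 1 (suc i)) ⟩
      suc (suc i + 1) % ℓ        ∎) flipsAt-1
      where open ≡-Reasoning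
    ...   | no 2+i≢ℓ with suc (suc i) ≟ z
    ...     | yes 2+i≡z = 1 , 3≤q , subst FlipsAt (cong suc (+-comm 1 (suc i)))
      (flipsAt-middle (≤-trans (<⇒≤ (≰⇒> 2+i≰q)) (n≤1+n _)) 3+i<ℓ λ 3+i≡z → 1+n≢n (trans 3+i≡z (sym 2+i≡z)))
      where
      3+i<ℓ : suc (suc (suc i)) < ℓ
      3+i<ℓ = subst (λ x → suc x < ℓ) (sym 2+i≡z) (subst (_≤ ℓ) (+-comm D 3) D+3≤ℓ)
    ...     | no 2+i≢z = 0 , ≤-trans (s≤s (s≤s z≤n)) 3≤q , subst FlipsAt (cong suc (sym (+-identityʳ (suc i))))
      (flipsAt-middle (<⇒≤ (≰⇒> 2+i≰q)) (≤∧≢⇒< 1+i<ℓ 2+i≢ℓ) 2+i≢z)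

module _ {r t n ℓ : ℕ} .{{_ : NonZero n}} where

  ¬weightable-0 : Fin ℓ → ¬ Weightable r t n ℓ 0
  ¬weightable-0 i (w , w∈ , _) with w∈ i
  ... | 1≤wi , wi≤0 = <⇒≱ (≤-trans 1≤wi wi≤0) ≤-refl

  weightable-mono : ∀ {k k′} → k ≤ k′ → Weightable r t n ℓ k → Weightable r t n ℓ k′
  weightable-mono k≤k′ (w , w∈ , proper) = w , (λ i → proj₁ (w∈ i) , ≤-trans (proj₂ (w∈ i)) k≤k′) , proper

  chiE≡-intro : ∀ {k} → Weightable r t n ℓ (suc k) → ¬ Weightable r t n ℓ k → ChiE≡ r t n ℓ (suc k)
  chiE≡-intro W ¬W = W , λ m m<1+k Wm → ¬W (weightable-mono (s≤s⁻¹ m<1+k) Wm)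

module _ {r t : ℕ} (t<r : t < r) where

  private
    r≡t+s : r ≡ t + (r ∸ t)
    r≡t+s = sym (m+[n∸m]≡n (<⇒≤ t<r))

  2t≡r⇒r≡2s : 2 * t ≡ r → r ≡ 2 * (r ∸ t)
  2t≡r⇒r≡2s 2t≡r = trans (sym 2t≡r) (cong (2 *_) t≡s)
    where
    t≡s : t ≡ r ∸ t
    t≡s = sym (trans (cong (_∸ t) (sym 2t≡r)) (trans (m+n∸m≡n t (t + 0)) (+-identityʳ t)))

  r<2t⇒3≤q : ∀ {q} → r < 2 * t → r ≡ q * (r ∸ t) → 3 ≤ q
  r<2t⇒3≤q {q} r<2t r≡q*s = *-cancelʳ-< s 2 q (begin-strict
    2 * s        ≡⟨ cong (s +_) (+-identityʳ s) ⟩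
    s + s        <⟨ +-monoˡ-< s s<t ⟩
    t + s        ≡⟨ r≡t+s ⟨
    r            ≡⟨ r≡q*s ⟩
    q * s        ∎)
    where
    open ≤-Reasoning
    s = r ∸ t
    s<t : s < t
    s<t = +-cancelˡ-< t s t (subst (_< t + t) r≡t+s (subst (r <_) (cong (t +_) (+-identityʳ t)) r<2t))

  s∣r⇒r≤2t : 1 ≤ t → (r ∸ t) ∣ r → r ≤ 2 * t
  s∣r⇒r≤2t 1≤t (divides q r≡q*s) = begin
    r            ≡⟨ r≡t+s ⟩
    t + s        ≤⟨ +-monoʳ-≤ t s≤t ⟩
    t + t        ≡⟨ cong (t +_) (+-identityʳ t) ⟨
    2 * t        ∎
    where
    open ≤-Reasoning
    s = r ∸ t
    s<r : s < r
    s<r = ∸-monoʳ-< 1≤t (<⇒≤ t<r)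
    2≤q : 2 ≤ q
    2≤q = *-cancelʳ-< s 1 q (subst (_< q * s) (sym (+-identityʳ s)) (subst (s <_) r≡q*s s<r))
    s≤t : s ≤ t
    s≤t = +-cancelʳ-≤ s s t (begin
      s + s      ≡⟨ cong (s +_) (+-identityʳ s) ⟨
      2 * s      ≤⟨ *-monoˡ-≤ s 2≤q ⟩
      q * s      ≡⟨ r≡q*s ⟨
      r          ≡⟨ r≡t+s ⟩
      t + s      ∎)

quotient<ℓ : ∀ {q r s ℓ} .{{_ : NonZero s}} → q * s ≤ r → r + s ≤ ℓ * s → q < ℓ
quotient<ℓ {q} {r} {s} {ℓ} q*s≤r r+s≤ℓ*s = *-cancelʳ-≤ (suc q) ℓ s (begin
  s + q * s    ≤⟨ +-monoʳ-≤ s q*s≤r ⟩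
  s + r        ≡⟨ +-comm s r ⟩
  r + s        ≤⟨ r+s≤ℓ*s ⟩
  ℓ * s        ∎)
  where open ≤-Reasoning

module TightCycle (r t ℓ : ℕ) {{_ : NonZero ℓ}} {{_ : NonZero (r ∸ t)}} (r+s≤n : r + (r ∸ t) ≤ ℓ * (r ∸ t)) where
  open Cycle ℓ

  s n : ℕ
  s = r ∸ t
  n = ℓ * s

  r≤n : r ≤ n
  r≤n = ≤-trans (m≤m+n r s) r+s≤n

  q*s≤r⇒q<ℓ : ∀ {q} → q * s ≤ r → q < ℓ
  q*s≤r⇒q<ℓ q*s≤r = quotient<ℓ q*s≤r r+s≤n

  instance
    n≢0 : NonZero n
    n≢0 = m*n≢0 ℓ s

  -- The vertex in slot b of block a; edge i starts with block i.
  vtx : ℕ → ℕ → Fin n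
  vtx a b = (a * s + b) mod n

  block slot : Fin n → ℕ
  block v = toℕ v / s
  slot v = toℕ v % s

  block-vtx : ∀ a {b} → b < s → block (vtx a b) ≡ a % ℓ
  block-vtx a {b} b<s = begin
    toℕ ((a * s + b) mod n) / s   ≡⟨ cong (_/ s) (FinP.toℕ-fromℕ< _) ⟩
    (a * s + b) % (ℓ * s) / s     ≡⟨ m%[n*o]/o≡m/o%n (a * s + b) ℓ s ⟩
    (a * s + b) / s % ℓ           ≡⟨ cong (_% ℓ) (+-distrib-/-∣ˡ b (n∣m*n a)) ⟩
    (a * s / s + b / s) % ℓ       ≡⟨ cong₂ (λ x y → (x + y) % ℓ) (m*n/n≡m a s) (m<n⇒m/n≡0 b<s) ⟩
    (a + 0) % ℓ                   ≡⟨ cong (_% ℓ) (+-identityʳ a) ⟩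
    a % ℓ                          ∎
    where open ≡-Reasoning

  slot-vtx : ∀ a {b} → b < s → slot (vtx a b) ≡ b
  slot-vtx a {b} b<s = begin
    toℕ ((a * s + b) mod n) % s   ≡⟨ cong (_% s) (FinP.toℕ-fromℕ< _) ⟩
    (a * s + b) % (ℓ * s) % s     ≡⟨ m∣n⇒o%n%m≡o%m s (ℓ * s) (a * s + b) (n∣m*n ℓ) ⟩
    (a * s + b) % s               ≡⟨ cong (_% s) (+-comm (a * s) b) ⟩
    (b + a * s) % s               ≡⟨ [m+kn]%n≡m%n b a s ⟩
    b % s                          ≡⟨ m<n⇒m%n≡m b<s ⟩
    b                              ∎
    where open ≡-Reasoning

  vtx-block-slot : ∀ v → vtx (block v) (slot v) ≡ v
  vtx-block-slot v = FinP.toℕ-injective (begin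
    toℕ (vtx (block v) (slot v))          ≡⟨ FinP.toℕ-fromℕ< _ ⟩
    (toℕ v / s * s + toℕ v % s) % n      ≡⟨ cong (_% n) (+-comm (toℕ v / s * s) _) ⟩
    (toℕ v % s + toℕ v / s * s) % n      ≡⟨ cong (_% n) (m≡m%n+[m/n]*n (toℕ v) s) ⟨
    toℕ v % n                             ≡⟨ m<n⇒m%n≡m (FinP.toℕ<n v) ⟩
    toℕ v                                 ∎)
    where open ≡-Reasoning

  slot<s : ∀ v → slot v < s
  slot<s v = m%n<n (toℕ v) s

  vtx-≡⇔ : ∀ a a′ {b b′} → b < s → b′ < s → vtx a b ≡ vtx a′ b′ ⇔ (a % ℓ ≡ a′ % ℓ × b ≡ b′)
  vtx-≡⇔ a a′ {b} {b′} b<s b′<s = mk⇔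
    (λ eq → trans (sym (block-vtx a b<s)) (trans (cong block eq) (block-vtx a′ b′<s))
          , trans (sym (slot-vtx a b<s)) (trans (cong slot eq) (slot-vtx a′ b′<s)))
    (λ (a≡a′ , b≡b′) → begin
      vtx a b                                  ≡⟨ vtx-block-slot (vtx a b) ⟨
      vtx (block (vtx a b)) (slot (vtx a b))  ≡⟨ cong₂ vtx (trans (block-vtx a b<s) (trans a≡a′ (sym (block-vtx a′ b′<s))))
                                                          (trans (slot-vtx a b<s) (trans b≡b′ (sym (slot-vtx a′ b′<s)))) ⟩
      vtx (block (vtx a′ b′)) (slot (vtx a′ b′)) ≡⟨ vtx-block-slot (vtx a′ b′) ⟩
      vtx a′ b′                                ∎)
    where open ≡-Reasoning

  vtx-shift : ∀ a k b → vtx a (k * s + b) ≡ vtx (a + k) b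
  vtx-shift a k b = cong (_mod n) (shift a k s b)
    where
    shift : ∀ a k s b → a * s + (k * s + b) ≡ (a + k) * s + b
    shift = solve-∀

  vtx-div : ∀ a j → vtx a j ≡ vtx (a + j / s) (j % s)
  vtx-div a j = trans (cong (vtx a) (trans (m≡m%n+[m/n]*n j s) (+-comm (j % s) _))) (vtx-shift a (j / s) (j % s))

  vtx-∈-edge : ∀ i {j} → j < r → vtx (toℕ i) j ∈ edge r t n ℓ i
  vtx-∈-edge i j<r = ∈-map⁺ (λ j → (toℕ i * s + j) mod n) (∈-upTo⁺ j<r)

  ∈-edge⇔ : ∀ a i {b} → b < s → vtx a b ∈ edge r t n ℓ i ⇔ offset a i * s + b < r
  ∈-edge⇔ a i {b} b<s = mk⇔ to from
    where
    from : offset a i * s + b < r → vtx a b ∈ edge r t n ℓ i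
    from o*s+b<r = subst (_∈ edge r t n ℓ i)
      (trans (vtx-shift (toℕ i) (offset a i) b) (Equivalence.from (vtx-≡⇔ _ a b<s b<s) (+-offset a i , refl)))
      (vtx-∈-edge i o*s+b<r)
    to : vtx a b ∈ edge r t n ℓ i → offset a i * s + b < r
    to v∈ with ∈-map⁻ (λ j → (toℕ i * s + j) mod n) v∈
    ... | j , j∈ , v≡ = subst (_< r) (sym o*s+b≡j) (∈-upTo⁻ j∈)
      where
      coords : a % ℓ ≡ (toℕ i + j / s) % ℓ × b ≡ j % s
      coords = Equivalence.to (vtx-≡⇔ a (toℕ i + j / s) b<s (m%n<n j s)) (trans v≡ (vtx-div (toℕ i) j))
      o≡ : offset a i ≡ j / s
      o≡ = offset-unique a i (m<n*o⇒m/o<n (≤-trans (∈-upTo⁻ j∈) r≤n)) (sym (proj₁ coords))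
      o*s+b≡j : offset a i * s + b ≡ j
      o*s+b≡j = trans (cong₂ (λ o b → o * s + b) o≡ (proj₂ coords))
                      (trans (+-comm (j / s * s) _) (sym (m≡m%n+[m/n]*n j s)))

  σᵉ-vtx : ∀ w a {b} → b < s → σᵉ r t n ℓ w (vtx a b) ≡ ∑ (λ i → ⟦ does (offset a i * s + b <? r) ⟧· w i)
  σᵉ-vtx w a {b} b<s = ∑-cong λ i → cong (⟦_⟧· w i)
    (does-⇔ (∈-edge⇔ a i b<s) (DecMem._∈?_ (FinP._≟_ {n}) (vtx a b) (edge r t n ℓ i)) (offset a i * s + b <? r))

  bichromatic : ∀ (c : Fin n → ℕ) i {j j′} → j < r → j′ < r → c (vtx (toℕ i) j) ≢ c (vtx (toℕ i) j′) →
    Σ (Fin n) λ u → Σ (Fin n) λ v → (u ∈ edge r t n ℓ i) × (v ∈ edge r t n ℓ i) × (c u ≢ c v)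
  bichromatic c i j<r j′<r c≢c = _ , _ , vtx-∈-edge i j<r , vtx-∈-edge i j′<r , c≢c

  0<s : 0 < s
  0<s = >-nonZero⁻¹ s

  module Division {q c} (r≡q*s+c : r ≡ q * s + c) (c<s : c < s) where

    q<ℓ : q < ℓ
    q<ℓ = q*s≤r⇒q<ℓ (subst (q * s ≤_) (sym r≡q*s+c) (m≤m+n (q * s) c))

    σᵉ-vtx-window : ∀ w a {b} → b < s → σᵉ r t n ℓ w (vtx a b) ≡ window w a q + ⟦ does (b <? c) ⟧· w (a ⊖ q)
    σᵉ-vtx-window w a {b} b<s = begin
      σᵉ r t n ℓ w (vtx a b)
        ≡⟨ σᵉ-vtx w a b<s ⟩
      ∑ (λ i → ⟦ does (offset a i * s + b <? r) ⟧· w i)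
        ≡⟨ ∑-cong (λ i → cong (λ R → ⟦ does (offset a i * s + b <? R) ⟧· w i) r≡q*s+c) ⟩
      ∑ (λ i → ⟦ does (offset a i * s + b <? q * s + c) ⟧· w i)
        ≡⟨ ∑-cong (λ i → ⟦*+<*+⟧ (offset a i) q (w i) b<s c<s) ⟩
      ∑ (λ i → ⟦ does (offset a i <? q) ⟧· w i + ⟦ does (offset a i ≟ q) ⟧· (⟦ does (b <? c) ⟧· w i))
        ≡⟨ ∑-+ {ℓ} _ _ ⟩
      window w a q + ∑ (λ i → ⟦ does (offset a i ≟ q) ⟧· (⟦ does (b <? c) ⟧· w i))
        ≡⟨ cong (window w a q +_) (∑-offset≟ (λ i → ⟦ does (b <? c) ⟧· w i) a q<ℓ) ⟩
      window w a q + ⟦ does (b <? c) ⟧· w (a ⊖ q)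
        ∎
      where open ≡-Reasoning

    weightable-1 : 0 < c → Weightable r t n ℓ 1
    weightable-1 0<c = one , (λ _ → ≤-refl , ≤-refl) , λ i →
      bichromatic (σᵉ r t n ℓ one) i (<-trans 0<c c<r) c<r (σ₀≢σc (toℕ i))
      where
      one : Fin ℓ → ℕ
      one _ = 1
      c<r : c < r
      c<r = <-≤-trans c<s (m∸n≤m r t)
      σ₀≢σc : ∀ a → σᵉ r t n ℓ one (vtx a 0) ≢ σᵉ r t n ℓ one (vtx a c)
      σ₀≢σc a σ₀≡σc = 1+n≢n (begin
        suc (window one a q)                          ≡⟨ +-comm 1 _ ⟩
        window one a q + 1                            ≡⟨ cong (window one a q +_) (⟦⟧·-yes (0 <? c) 0<c) ⟨
        window one a q + ⟦ does (0 <? c) ⟧· 1         ≡⟨ σᵉ-vtx-window one a 0<s ⟨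
        σᵉ r t n ℓ one (vtx a 0)                      ≡⟨ σ₀≡σc ⟩
        σᵉ r t n ℓ one (vtx a c)                      ≡⟨ σᵉ-vtx-window one a c<s ⟩
        window one a q + ⟦ does (c <? c) ⟧· 1         ≡⟨ cong (window one a q +_) (⟦⟧·-no (c <? c) (<-irrefl refl)) ⟩
        window one a q + 0                            ≡⟨ +-identityʳ _ ⟩
        window one a q                                ∎)
        where open ≡-Reasoning

  s∤r⇒chiE≡1 : r % s ≢ 0 → ChiE≡ r t n ℓ 1
  s∤r⇒chiE≡1 r%s≢0 =
    chiE≡-intro {t = t} (weightable-1 (n≢0⇒n>0 r%s≢0)) (¬weightable-0 {t = t} (fromℕ< (>-nonZero⁻¹ ℓ)))
    where open Division {r / s} (trans (m≡m%n+[m/n]*n r s) (+-comm (r % s) _)) (m%n<n r s)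

  module Blocks {p} (r≡q*s : r ≡ suc p * s) where
    q : ℕ
    q = suc p

    r≡q*s+0 : r ≡ q * s + 0
    r≡q*s+0 = trans r≡q*s (sym (+-identityʳ (q * s)))

    open Division {q} {0} r≡q*s+0 0<s

    p<ℓ : p < ℓ
    p<ℓ = <-trans (n<1+n p) q<ℓ

    σᵉ-vtx-block : ∀ w a {b} → b < s → σᵉ r t n ℓ w (vtx a b) ≡ window w a q
    σᵉ-vtx-block w a b<s = trans (σᵉ-vtx-window w a b<s) (+-identityʳ _)

    σᵉ-block : ∀ w v → σᵉ r t n ℓ w v ≡ window w (block v) q
    σᵉ-block w v = trans (cong (σᵉ r t n ℓ w) (sym (vtx-block-slot v))) (σᵉ-vtx-block w (block v) (slot<s v))

    ¬weightable-1 : ¬ Weightable r t n ℓ 1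
    ¬weightable-1 (w , w∈ , proper) with proper (fromℕ< (>-nonZero⁻¹ ℓ))
    ... | u , v , _ , _ , σu≢σv = σu≢σv (trans (σᵉ≡ u) (sym (σᵉ≡ v)))
      where
      w-const : ∀ i j → w i ≡ w j
      w-const i j = trans (≤-antisym (proj₂ (w∈ i)) (proj₁ (w∈ i))) (≤-antisym (proj₁ (w∈ j)) (proj₂ (w∈ j)))
      σᵉ≡ : ∀ v → σᵉ r t n ℓ w v ≡ window w 0 q
      σᵉ≡ v = trans (σᵉ-block w v) (window-constant w p<ℓ w-const (block v))

    σᵉ-∈-edge : ∀ w i {u} → u ∈ edge r t n ℓ i → ∃ λ e → e < q × σᵉ r t n ℓ w u ≡ window w (toℕ i + e) q
    σᵉ-∈-edge w i {u} u∈ with ∈-map⁻ (λ j → (toℕ i * s + j) mod n) u∈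
    ... | j , j∈ , u≡ = j / s , m<n*o⇒m/o<n (subst (j <_) r≡q*s (∈-upTo⁻ j∈)) , (begin
      σᵉ r t n ℓ w u                                 ≡⟨ cong (σᵉ r t n ℓ w) u≡ ⟩
      σᵉ r t n ℓ w (vtx (toℕ i) j)                   ≡⟨ cong (σᵉ r t n ℓ w) (vtx-div (toℕ i) j) ⟩
      σᵉ r t n ℓ w (vtx (toℕ i + j / s) (j % s))     ≡⟨ σᵉ-vtx-block w (toℕ i + j / s) (m%n<n j s) ⟩
      window w (toℕ i + j / s) q                      ∎)
      where open ≡-Reasoning

    proper⇒window-varies : ∀ w → Proper r t n ℓ (σᵉ r t n ℓ w) → ∀ i →
      ¬ (∀ e → e < q → window w (toℕ i + e) q ≡ window w (toℕ i) q)
    proper⇒window-varies w proper i constant =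
      let u , v , u∈ , v∈ , σu≢σv = proper i
          e , e<q , σu≡ = σᵉ-∈-edge w i u∈
          e′ , e′<q , σv≡ = σᵉ-∈-edge w i v∈
      in σu≢σv (trans σu≡ (trans (constant e e<q) (sym (trans σv≡ (constant e′ e′<q)))))

    proper-of-jumps : ∀ w → (∀ i → ∃ λ e → suc e < q × w (suc (toℕ i + e) ⊖ q) ≢ w (suc (toℕ i + e) mod ℓ)) →
      Proper r t n ℓ (σᵉ r t n ℓ w)
    proper-of-jumps w jumps i with jumps i
    ... | e , 1+e<q , jump = bichromatic (σᵉ r t n ℓ w) i (e*s<r (<-trans (n<1+n e) 1+e<q)) (e*s<r 1+e<q) σ≢σ
      where
      e*s<r : ∀ {e} → e < q → e * s + 0 < r
      e*s<r {e} e<q = subst (e * s + 0 <_) (sym r≡q*s+0) (<⇒*+<*+ {c = 0} 0<s e<q)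
      σᵉ-at : ∀ e → σᵉ r t n ℓ w (vtx (toℕ i) (e * s + 0)) ≡ window w (toℕ i + e) q
      σᵉ-at e = trans (cong (σᵉ r t n ℓ w) (vtx-shift (toℕ i) e 0)) (σᵉ-vtx-block w (toℕ i + e) 0<s)
      σ≢σ : σᵉ r t n ℓ w (vtx (toℕ i) (e * s + 0)) ≢ σᵉ r t n ℓ w (vtx (toℕ i) (suc e * s + 0))
      σ≢σ σ≡σ = jump (Equivalence.to (window-suc≡⇔ w (toℕ i + e) p<ℓ) (begin
        window w (suc (toℕ i + e)) q                   ≡⟨ cong (λ x → window w x q) (+-suc (toℕ i) e) ⟨
        window w (toℕ i + suc e) q                     ≡⟨ σᵉ-at (suc e) ⟨
        σᵉ r t n ℓ w (vtx (toℕ i) (suc e * s + 0))     ≡⟨ σ≡σ ⟨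
        σᵉ r t n ℓ w (vtx (toℕ i) (e * s + 0))         ≡⟨ σᵉ-at e ⟩
        window w (toℕ i + e) q                          ∎))
        where open ≡-Reasoning

  module Pairs (r≡2*s : r ≡ 2 * s) where
    open Blocks {1} r≡2*s

    2<ℓ : 2 < ℓ
    2<ℓ = q*s≤r⇒q<ℓ (≤-reflexive (sym r≡2*s))

    proper⇔alternating : ∀ w → Proper r t n ℓ (σᵉ r t n ℓ w) ⇔ (∀ j → w j ≢ w (plus2 j))
    proper⇔alternating w = mk⇔ to from
      where
      2≤ℓ : 2 ≤ ℓ
      2≤ℓ = <⇒≤ 2<ℓ
      from : (∀ j → w j ≢ w (plus2 j)) → Proper r t n ℓ (σᵉ r t n ℓ w)
      from alternating = proper-of-jumps w λ i → 0 , ≤-refl , λ eq →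
        alternating (suc (toℕ i + 0) ⊖ 2) (trans eq (cong w (sym (plus2-⊖2 2≤ℓ (suc (toℕ i + 0))))))
      to : Proper r t n ℓ (σᵉ r t n ℓ w) → ∀ j → w j ≢ w (plus2 j)
      to proper j wj≡wj+2 = proper⇒window-varies w proper i constant
        where
        i : Fin ℓ
        i = (toℕ j + 1) mod ℓ
        no-jump : w (suc (toℕ i) ⊖ 2) ≡ w (suc (toℕ i) mod ℓ)
        no-jump = begin
          w (suc (toℕ i) ⊖ 2)             ≡⟨ cong w (⊖2-plus1 2≤ℓ j) ⟩
          w j                             ≡⟨ wj≡wj+2 ⟩
          w (plus2 j)                     ≡⟨ cong (w ∘′ plus2) (⊖2-plus1 2≤ℓ j) ⟨
          w (plus2 (suc (toℕ i) ⊖ 2))     ≡⟨ cong w (plus2-⊖2 2≤ℓ (suc (toℕ i))) ⟩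
          w (suc (toℕ i) mod ℓ)           ∎
          where open ≡-Reasoning
        constant : ∀ e → e < 2 → window w (toℕ i + e) 2 ≡ window w (toℕ i) 2
        constant 0 _ = cong (λ x → window w x 2) (+-identityʳ (toℕ i))
        constant 1 _ = trans (cong (λ x → window w x 2) (+-comm (toℕ i) 1))
          (Equivalence.from (window-suc≡⇔ w (toℕ i) p<ℓ) no-jump)
        constant (suc (suc _)) (s≤s (s≤s ()))

    weightable-2 : 4 ∣ ℓ → Weightable r t n ℓ 2
    weightable-2 4∣ℓ = stripes , stripes∈ , Equivalence.from (proper⇔alternating stripes) (stripes-alternating 4∣ℓ)

    ¬weightable-2 : ¬ 4 ∣ ℓ → ¬ Weightable r t n ℓ 2
    ¬weightable-2 4∤ℓ (w , w∈ , proper) = 4∤ℓ (alternating⇒4∣ℓ w w∈ (Equivalence.to (proper⇔alternating w) proper))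

    weightable-3 : Weightable r t n ℓ 3
    weightable-3 = stripes₃ , (λ j → colour₃∈ (toℕ j)) ,
      Equivalence.from (proper⇔alternating stripes₃) (stripes₃-alternating 2<ℓ)

    4∤ℓ⇒chiE≡3 : ¬ 4 ∣ ℓ → ChiE≡ r t n ℓ 3
    4∤ℓ⇒chiE≡3 4∤ℓ = chiE≡-intro {t = t} weightable-3 (¬weightable-2 4∤ℓ)

    4∣ℓ⇒chiE≡2 : 4 ∣ ℓ → ChiE≡ r t n ℓ 2
    4∣ℓ⇒chiE≡2 4∣ℓ = chiE≡-intro {t = t} (weightable-2 4∣ℓ) ¬weightable-1

  3≤q⇒chiE≡2 : ∀ {q} → r ≡ q * s → 3 ≤ q → ChiE≡ r t n ℓ 2
  3≤q⇒chiE≡2 {suc p} r≡q*s 3≤q = chiE≡-intro {t = t} (w , (λ j → runs∈ (toℕ j)) , proper) ¬weightable-1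
    where
    open Blocks {p} r≡q*s
    open Runs 3≤q (q*s≤r⇒q<ℓ (≤-reflexive (sym r≡q*s)))
    w : Fin ℓ → ℕ
    w j = runs (toℕ j)
    proper : Proper r t n ℓ (σᵉ r t n ℓ w)
    proper = proper-of-jumps w λ i → flipsAt-window (toℕ i) (FinP.toℕ<n i)

theorem3p5 : (r t n ℓ : ℕ) .{{_ : NonZero n}} →
    1 ≤ t → t < r → n ≡ ℓ * (r ∸ t) → 2 < ℓ →
    r + (r ∸ t) ≤ n →
    ((2 * t ≡ r → ¬ (4 ∣ ℓ) → ChiE≡ r t n ℓ 3)
    × ((((2 * t ≡ r) × (4 ∣ ℓ)) ⊎ ((r < 2 * t) × ((r ∸ t) ∣ r))) → ChiE≡ r t n ℓ 2)
    × (¬ (2 * t ≡ r) → ¬ ((r < 2 * t) × ((r ∸ t) ∣ r)) → ChiE≡ r t n ℓ 1))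
theorem3p5 r t .(ℓ * (r ∸ t)) ℓ 1≤t t<r refl 2<ℓ r+s≤n = chiE≡3 , chiE≡2 , chiE≡1
  where
  instance
    ℓ≢0 : NonZero ℓ
    ℓ≢0 = >-nonZero (<-trans (s≤s z≤n) 2<ℓ)
    s≢0 : NonZero (r ∸ t)
    s≢0 = >-nonZero (m<n⇒0<n∸m t<r)

  open TightCycle r t ℓ r+s≤n

  chiE≡3 : 2 * t ≡ r → ¬ 4 ∣ ℓ → ChiE≡ r t n ℓ 3
  chiE≡3 2t≡r = Pairs.4∤ℓ⇒chiE≡3 (2t≡r⇒r≡2s t<r 2t≡r)

  chiE≡2 : (2 * t ≡ r × 4 ∣ ℓ) ⊎ (r < 2 * t × s ∣ r) → ChiE≡ r t n ℓ 2
  chiE≡2 (inj₁ (2t≡r , 4∣ℓ)) = Pairs.4∣ℓ⇒chiE≡2 (2t≡r⇒r≡2s t<r 2t≡r) 4∣ℓ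
  chiE≡2 (inj₂ (r<2t , divides q r≡q*s)) = 3≤q⇒chiE≡2 {q} r≡q*s (r<2t⇒3≤q t<r r<2t r≡q*s)

  chiE≡1 : ¬ 2 * t ≡ r → ¬ (r < 2 * t × s ∣ r) → ChiE≡ r t n ℓ 1
  chiE≡1 2t≢r ¬[r<2t×s∣r] = s∤r⇒chiE≡1 λ r%s≡0 →
    let s∣r = m%n≡0⇒n∣m r s r%s≡0 in
    [ (λ r<2t → ¬[r<2t×s∣r] (r<2t , s∣r)) , (λ r≡2t → 2t≢r (sym r≡2t)) ]′
      (m≤n⇒m<n∨m≡n (s∣r⇒r≤2t t<r 1≤t s∣r))
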